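{- Let $C\subseteq\mathbb{Z}_2^n$ be a $10$-cap of dimension $7$ that has a basis of extended type $7\text{ - }5\text{ - }(4)$. Then $C$ has a basis of extended type $5\text{ - }5\text{ - }(2)$.
   Context: Work in $\mathbb{Z}_2^n$. An affine combination of a set is a sum of an odd number of its distinct elements; $\operatorname{aff}(S)$ is the set of all affine combinations of elements of $S$, and the dimension of $S$ is the dimension of the affine flat $\operatorname{aff}(S)$. A basis for $S$ is a subset $B\subseteq S$ that is affinely independent (no element is an affine combination of the others) with $\operatorname{aff}(B)=\operatorname{aff}(S)$; its dependent set is $D=S\setminus B$. For $x\in D$, $B_x$ is the unique subset of $B$ whose elements sum to $x$. A quad is a set of four distinct elements summing to $\mathbf{0}$; a cap is a quad-free subset; a $k$-cap is a cap with $k$ elements. For $D=\{x_1,x_2\}$, a basis $B$ has extended type $n_1\text{ - }n_2\text{ - }(m)$ if the elements of $D$ can be labeled $x_1,x_2$ so that $|B_{x_1}|=n_1$, $|B_{x_2}|=n_2$ and $|B_{x_1}\cap B_{x_2}|=m$. -}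

module Defs where

open import Data.Bool using (Bool; true; false; _xor_; if_then_else_)
open import Data.Nat using (ℕ; zero; suc; _%_)
open import Data.Fin using (Fin; zero; suc)
open import Data.Fin.Subset using (Subset; ⊤; _∈_; _∉_; _⊆_; _∩_; _∪_; ∁; ⁅_⁆; ∣_∣; _─_)
open import Data.Vec using (Vec; []; _∷_; replicate; zipWith)
open import Data.Product using (Σ; ∃; _×_)
open import Function.Bundles using (_⇔_)
open import Relation.Nullary using (¬_)
open import Relation.Binary.PropositionalEquality using (_≡_; _≢_)

Point : ℕ → Set
Point n = Vec Bool n

𝟎 : ∀ {n} → Point n
𝟎 {n} = replicate n false

infixl 6 _⊕_
_⊕_ : ∀ {n} → Point n → Point n → Point n
_⊕_ = zipWith _xor_

Odd : ℕ → Set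
Odd k = k % 2 ≡ 1

-- A finite set of m distinct points is given as an injective family p : Fin m → Point n;
-- subsets of it are subsets T : Subset m of the index set.
sumOver : ∀ {m n} → (Fin m → Point n) → Subset m → Point n
sumOver {zero}  p []      = 𝟎
sumOver {suc m} p (b ∷ T) = (if b then p zero else 𝟎) ⊕ sumOver (λ i → p (suc i)) T

-- x is an affine combination of (the elements indexed by) S:
-- a sum of an odd number of distinct elements of S.
AffComb : ∀ {m n} → (Fin m → Point n) → Subset m → Point n → Set
AffComb p S x = Σ _ λ T → T ⊆ S × Odd ∣ T ∣ × sumOver p T ≡ x

InAff : ∀ {m n} → (Fin m → Point n) → Subset m → Point n → Set
InAff = AffComb

AffIndep : ∀ {m n} → (Fin m → Point n) → Subset m → Set
AffIndep p S = ∀ i → i ∈ S → ¬ (AffComb p (S ─ ⁅ i ⁆) (p i))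

HasDim : ∀ {m n} → (Fin m → Point n) → Subset m → ℕ → Set
HasDim {m} {n} p S d =
  Σ (Fin (suc d) → Point n) λ q → AffIndep q ⊤ × (∀ x → InAff p S x ⇔ InAff q ⊤ x)

IsBasisOf : ∀ {m n} → (Fin m → Point n) → Subset m → Subset m → Set
IsBasisOf p S B = B ⊆ S × AffIndep p B × (∀ x → InAff p B x ⇔ InAff p S x)

IsRep : ∀ {m n} → (Fin m → Point n) → Subset m → Fin m → Subset m → Set
IsRep p B x T = T ⊆ B × Odd ∣ T ∣ × sumOver p T ≡ p x

-- basis B of the whole family (S = ⊤, so D = ∁ B) has extended type n₁-n₂-(k):
-- D = {x₁, x₂} with |B_{x₁}| = n₁, |B_{x₂}| = n₂, |B_{x₁} ∩ B_{x₂}| = k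
ExtType : ∀ {m n} → (Fin m → Point n) → Subset m → ℕ → ℕ → ℕ → Set
ExtType p B n₁ n₂ k =
  Σ _ λ x₁ → Σ _ λ x₂ → x₁ ≢ x₂ × ∁ B ≡ ⁅ x₁ ⁆ ∪ ⁅ x₂ ⁆ ×
  Σ _ λ T₁ → Σ _ λ T₂ → IsRep p B x₁ T₁ × IsRep p B x₂ T₂ ×
  ∣ T₁ ∣ ≡ n₁ × ∣ T₂ ∣ ≡ n₂ × ∣ T₁ ∩ T₂ ∣ ≡ k

IsCap : ∀ {m n} → (Fin m → Point n) → Set
IsCap p = ∀ i j k l → i ≢ j → i ≢ k → i ≢ l → j ≢ k → j ≢ l → k ≢ l →
  p i ⊕ p j ⊕ p k ⊕ p l ≢ 𝟎

-- Pick c ∈ B_{x₁} ∩ B_{x₂} and exchange it for x₂: B′ = B − c + x₂ is again a basis, with dependent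
-- set {x₁, c}.  The circuit B_{x₂} + x₂ (even, summing to 𝟎) rewrites the representations:
-- B′_{x₁} = B_{x₁} Δ B_{x₂} + x₂ and B′_c = B_{x₂} − c + x₂, of sizes 7 + 5 − 2·4 + 1 = 5 and 5.
-- Their symmetric difference is B_{x₁} − c, of size 6, so they meet in 2 points.
module Submission where

open import Defs
open import Data.Bool using (Bool; true; false; _xor_; if_then_else_)
open import Data.Bool.Properties
  using (xor-assoc; xor-comm; xor-identityˡ; xor-identityʳ; xor-same; not-distribˡ-xor)
open import Data.Empty using (⊥-elim)
open import Data.Fin using (Fin; zero; suc; _≟_)
open import Data.Fin.Subset
  using (Subset; ⊤; ⊥; _∈_; _∉_; _⊆_; _∩_; _∪_; ∁; ⁅_⁆; ∣_∣; _─_; Nonempty; Empty)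
open import Data.Fin.Subset.Properties
  using ( _∈?_; drop-there; ∈⊤; x∈⁅x⁆; x∈⁅y⁆⇒x≡y; x≢y⇒x∉⁅y⁆; ∣⁅x⁆∣≡1; ⊆-trans
        ; x∈∁p⇒x∉p; x∈p∪q⁺; x∈p∩q⁻; x∈p∧x∉q⇒x∈p─q; p─q⊆p)
open import Data.Nat using (ℕ; zero; suc; _+_; _*_; _%_)
open import Data.Nat.Properties using (+-suc; *-comm; +-cancelˡ-≡; +-cancelʳ-≡; *-cancelˡ-≡; suc-injective)
open import Data.Nat.DivMod using ([m+kn]%n≡m%n; %-distribˡ-+)
open import Data.Nat.Tactic.RingSolver using (solve-∀)
open import Data.Product using (Σ; _×_; _,_; proj₁; proj₂)
open import Data.Sum using (_⊎_; inj₁; inj₂)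
open import Data.Vec using (Vec; []; _∷_; here; there)
open import Data.Vec.Properties using (zipWith-assoc; zipWith-comm; zipWith-identityˡ; zipWith-identityʳ)
open import Function using (_∘_)
open import Function.Bundles using (mk⇔; Equivalence)
open import Function.Definitions using (Injective)
open import Relation.Nullary using (yes; no)
open import Relation.Binary.PropositionalEquality
open ≡-Reasoning

-- ℤ₂ⁿ under ⊕; subsets of Fin m are the vectors of ℤ₂ᵐ, with ⊕ the symmetric difference

module _ {n : ℕ} where

  ⊕-assoc : (x y z : Vec Bool n) → (x ⊕ y) ⊕ z ≡ x ⊕ (y ⊕ z)
  ⊕-assoc = zipWith-assoc xor-assoc

  ⊕-comm : (x y : Vec Bool n) → x ⊕ y ≡ y ⊕ x
  ⊕-comm = zipWith-comm xor-comm

  ⊕-identityˡ : (x : Vec Bool n) → 𝟎 ⊕ x ≡ x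
  ⊕-identityˡ = zipWith-identityˡ xor-identityˡ

  ⊕-identityʳ : (x : Vec Bool n) → x ⊕ 𝟎 ≡ x
  ⊕-identityʳ = zipWith-identityʳ xor-identityʳ

⊕-self : ∀ {n} (x : Vec Bool n) → x ⊕ x ≡ 𝟎
⊕-self []      = refl
⊕-self (b ∷ x) = cong₂ _∷_ (xor-same b) (⊕-self x)

module _ {n : ℕ} where

  ⊕-involutive : (x y : Vec Bool n) → (x ⊕ y) ⊕ y ≡ x
  ⊕-involutive x y = begin
    (x ⊕ y) ⊕ y  ≡⟨ ⊕-assoc x y y ⟩
    x ⊕ (y ⊕ y)  ≡⟨ cong (x ⊕_) (⊕-self y) ⟩
    x ⊕ 𝟎        ≡⟨ ⊕-identityʳ x ⟩
    x            ∎

  ⊕-interchange : (w x y z : Vec Bool n) → (w ⊕ x) ⊕ (y ⊕ z) ≡ (w ⊕ y) ⊕ (x ⊕ z)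
  ⊕-interchange w x y z = begin
    (w ⊕ x) ⊕ (y ⊕ z)  ≡⟨ ⊕-assoc w x (y ⊕ z) ⟩
    w ⊕ (x ⊕ (y ⊕ z))  ≡⟨ cong (w ⊕_) (sym (⊕-assoc x y z)) ⟩
    w ⊕ ((x ⊕ y) ⊕ z)  ≡⟨ cong (λ v → w ⊕ (v ⊕ z)) (⊕-comm x y) ⟩
    w ⊕ ((y ⊕ x) ⊕ z)  ≡⟨ cong (w ⊕_) (⊕-assoc y x z) ⟩
    w ⊕ (y ⊕ (x ⊕ z))  ≡⟨ sym (⊕-assoc w y (x ⊕ z)) ⟩
    (w ⊕ y) ⊕ (x ⊕ z)  ∎

  ⊕-cancel-common : (x y z : Vec Bool n) → (x ⊕ z) ⊕ (y ⊕ z) ≡ x ⊕ y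
  ⊕-cancel-common x y z = begin
    (x ⊕ z) ⊕ (y ⊕ z)  ≡⟨ ⊕-interchange x z y z ⟩
    (x ⊕ y) ⊕ (z ⊕ z)  ≡⟨ cong ((x ⊕ y) ⊕_) (⊕-self z) ⟩
    (x ⊕ y) ⊕ 𝟎        ≡⟨ ⊕-identityʳ (x ⊕ y) ⟩
    x ⊕ y              ∎

∁-⊕ : ∀ {n} (S T : Subset n) → ∁ (S ⊕ T) ≡ ∁ S ⊕ T
∁-⊕ []      []      = refl
∁-⊕ (a ∷ S) (b ∷ T) = cong₂ _∷_ (not-distribˡ-xor a b) (∁-⊕ S T)

disjoint⇒∪≡⊕ : ∀ {n} (S T : Subset n) → (∀ {i} → i ∈ S → i ∉ T) → S ∪ T ≡ S ⊕ T
disjoint⇒∪≡⊕ []          []          _ = refl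
disjoint⇒∪≡⊕ (true  ∷ S) (true  ∷ T) d = ⊥-elim (d here here)
disjoint⇒∪≡⊕ (true  ∷ S) (false ∷ T) d = cong (true ∷_) (disjoint⇒∪≡⊕ S T λ i∈S → d (there i∈S) ∘ there)
disjoint⇒∪≡⊕ (false ∷ S) (b     ∷ T) d = cong (b ∷_) (disjoint⇒∪≡⊕ S T λ i∈S → d (there i∈S) ∘ there)

x∈p⊕q⁻ : ∀ {n} {S T : Subset n} {i} → i ∈ S ⊕ T → i ∈ S × i ∉ T ⊎ i ∉ S × i ∈ T
x∈p⊕q⁻ {S = true  ∷ _} {false ∷ _} here = inj₁ (here , λ ())
x∈p⊕q⁻ {S = false ∷ _} {true  ∷ _} here = inj₂ ((λ ()) , here)
x∈p⊕q⁻ {S = _ ∷ _} {_ ∷ _} (there i∈) with x∈p⊕q⁻ i∈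
... | inj₁ (i∈S , i∉T) = inj₁ (there i∈S , i∉T ∘ drop-there)
... | inj₂ (i∉S , i∈T) = inj₂ (i∉S ∘ drop-there , there i∈T)

x∈p⊕q⁺ˡ : ∀ {n} {S T : Subset n} {i} → i ∈ S → i ∉ T → i ∈ S ⊕ T
x∈p⊕q⁺ˡ {T = false ∷ _} here        _   = here
x∈p⊕q⁺ˡ {T = true  ∷ _} here        i∉T = ⊥-elim (i∉T here)
x∈p⊕q⁺ˡ {T = _ ∷ _}     (there i∈S) i∉T = there (x∈p⊕q⁺ˡ i∈S (i∉T ∘ there))

x∈p⊕q⁺ʳ : ∀ {n} {S T : Subset n} {i} → i ∉ S → i ∈ T → i ∈ S ⊕ T
x∈p⊕q⁺ʳ {S = S} {T} i∉S i∈T = subst (_ ∈_) (⊕-comm T S) (x∈p⊕q⁺ˡ i∈T i∉S)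

x∈p∧x∈q⇒x∉p⊕q : ∀ {n} {S T : Subset n} {i} → i ∈ S → i ∈ T → i ∉ S ⊕ T
x∈p∧x∈q⇒x∉p⊕q i∈S i∈T i∈S⊕T with x∈p⊕q⁻ i∈S⊕T
... | inj₁ (_ , i∉T) = i∉T i∈T
... | inj₂ (i∉S , _) = i∉S i∈S

x∈p─q⇒x∉q : ∀ {n} {S U : Subset n} {i} → i ∈ S ─ U → i ∉ U
x∈p─q⇒x∉q {S = _ ∷ _} {false ∷ _} here        ()
x∈p─q⇒x∉q {S = _ ∷ _} {_ ∷ _}     (there i∈) i∈U = x∈p─q⇒x∉q i∈ (drop-there i∈U)

x∉p∧x∉q⇒x∉p⊕q : ∀ {n} {S T : Subset n} {i} → i ∉ S → i ∉ T → i ∉ S ⊕ T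
x∉p∧x∉q⇒x∉p⊕q i∉S i∉T i∈S⊕T with x∈p⊕q⁻ i∈S⊕T
... | inj₁ (i∈S , _) = i∉S i∈S
... | inj₂ (_ , i∈T) = i∉T i∈T

module _ {n : ℕ} {S : Subset n} {i j : Fin n} where

  ∈-⊕⁅⁆⁺ : j ∈ S → j ≢ i → j ∈ S ⊕ ⁅ i ⁆
  ∈-⊕⁅⁆⁺ j∈S j≢i = x∈p⊕q⁺ˡ j∈S (x≢y⇒x∉⁅y⁆ j≢i)

  ∈-⊕⁅⁆⁻ : j ∈ S ⊕ ⁅ i ⁆ → j ≢ i → j ∈ S
  ∈-⊕⁅⁆⁻ j∈ j≢i with x∈p⊕q⁻ j∈
  ... | inj₁ (j∈S , _)  = j∈S
  ... | inj₂ (_ , j∈⁅i⁆) = ⊥-elim (j≢i (x∈⁅y⁆⇒x≡y i j∈⁅i⁆))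

  ∉-⊕⁅⁆ : j ∉ S → j ≢ i → j ∉ S ⊕ ⁅ i ⁆
  ∉-⊕⁅⁆ j∉S j≢i = j∉S ∘ λ j∈ → ∈-⊕⁅⁆⁻ j∈ j≢i

⁅⁆-⊆ : ∀ {n} {S : Subset n} {i} → i ∈ S → ⁅ i ⁆ ⊆ S
⁅⁆-⊆ {i = i} i∈S j∈⁅i⁆ rewrite x∈⁅y⁆⇒x≡y i j∈⁅i⁆ = i∈S

module _ {n : ℕ} {S U : Subset n} where

  ⊆-⊕ : ∀ {T} → S ⊆ U → T ⊆ U → S ⊕ T ⊆ U
  ⊆-⊕ S⊆U T⊆U j∈ with x∈p⊕q⁻ j∈
  ... | inj₁ (j∈S , _) = S⊆U j∈S
  ... | inj₂ (_ , j∈T) = T⊆U j∈T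

  module _ {i : Fin n} where

    ⊆-⊕⁅⁆⁺ : i ∉ S → S ⊆ U → S ⊆ U ⊕ ⁅ i ⁆
    ⊆-⊕⁅⁆⁺ i∉S S⊆U j∈S = ∈-⊕⁅⁆⁺ (S⊆U j∈S) λ { refl → i∉S j∈S }

    ⊆-⊕⁅⁆⁻ : i ∉ S → S ⊆ U ⊕ ⁅ i ⁆ → S ⊆ U
    ⊆-⊕⁅⁆⁻ i∉S S⊆ j∈S = ∈-⊕⁅⁆⁻ (S⊆ j∈S) λ { refl → i∉S j∈S }

    ⊕⁅⁆-mono-⊆ : i ∉ U → S ⊆ U → S ⊕ ⁅ i ⁆ ⊆ U ⊕ ⁅ i ⁆
    ⊕⁅⁆-mono-⊆ i∉U S⊆U {j} j∈ with j ≟ i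
    ... | yes refl = x∈p⊕q⁺ʳ i∉U (x∈⁅x⁆ i)
    ... | no  j≢i  = ∈-⊕⁅⁆⁺ (S⊆U (∈-⊕⁅⁆⁻ j∈ j≢i)) j≢i

    ⊕⁅⁆-⊆ : i ∈ S → S ⊆ U ⊕ ⁅ i ⁆ → S ⊕ ⁅ i ⁆ ⊆ U
    ⊕⁅⁆-⊆ i∈S S⊆ {j} j∈ with j ≟ i
    ... | yes refl = ⊥-elim (x∈p∧x∈q⇒x∉p⊕q i∈S (x∈⁅x⁆ i) j∈)
    ... | no  j≢i  = ∈-⊕⁅⁆⁻ (S⊆ (∈-⊕⁅⁆⁻ j∈ j≢i)) j≢i

∣⊕∣+2∣∩∣ : ∀ {n} (S T : Subset n) → ∣ S ⊕ T ∣ + 2 * ∣ S ∩ T ∣ ≡ ∣ S ∣ + ∣ T ∣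
∣⊕∣+2∣∩∣ []          []          = refl
∣⊕∣+2∣∩∣ (false ∷ S) (false ∷ T) = ∣⊕∣+2∣∩∣ S T
∣⊕∣+2∣∩∣ (true  ∷ S) (false ∷ T) = cong suc (∣⊕∣+2∣∩∣ S T)
∣⊕∣+2∣∩∣ (false ∷ S) (true  ∷ T) = trans (cong suc (∣⊕∣+2∣∩∣ S T)) (sym (+-suc ∣ S ∣ ∣ T ∣))
∣⊕∣+2∣∩∣ (true  ∷ S) (true  ∷ T) = begin
  ∣ S ⊕ T ∣ + 2 * suc ∣ S ∩ T ∣    ≡⟨ shift ∣ S ⊕ T ∣ ∣ S ∩ T ∣ ⟩
  2 + (∣ S ⊕ T ∣ + 2 * ∣ S ∩ T ∣)  ≡⟨ cong (2 +_) (∣⊕∣+2∣∩∣ S T) ⟩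
  2 + (∣ S ∣ + ∣ T ∣)              ≡⟨ cong suc (sym (+-suc ∣ S ∣ ∣ T ∣)) ⟩
  suc ∣ S ∣ + suc ∣ T ∣            ∎
  where
  shift : ∀ a k → a + 2 * suc k ≡ 2 + (a + 2 * k)
  shift = solve-∀

∣⊕⁅⁆∣-∉ : ∀ {n} {S : Subset n} {i} → i ∉ S → ∣ S ⊕ ⁅ i ⁆ ∣ ≡ suc ∣ S ∣
∣⊕⁅⁆∣-∉ {S = false ∷ S} {zero}  _   = cong (suc ∘ ∣_∣) (⊕-identityʳ S)
∣⊕⁅⁆∣-∉ {S = true  ∷ S} {zero}  i∉S = ⊥-elim (i∉S here)
∣⊕⁅⁆∣-∉ {S = false ∷ S} {suc i} i∉S = ∣⊕⁅⁆∣-∉ (i∉S ∘ there)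
∣⊕⁅⁆∣-∉ {S = true  ∷ S} {suc i} i∉S = cong suc (∣⊕⁅⁆∣-∉ (i∉S ∘ there))

∣⊕⁅⁆∣-∈ : ∀ {n} {S : Subset n} {i} → i ∈ S → suc ∣ S ⊕ ⁅ i ⁆ ∣ ≡ ∣ S ∣
∣⊕⁅⁆∣-∈ {S = true  ∷ S} here        = cong (suc ∘ ∣_∣) (⊕-identityʳ S)
∣⊕⁅⁆∣-∈ {S = false ∷ S} (there i∈S) = ∣⊕⁅⁆∣-∈ i∈S
∣⊕⁅⁆∣-∈ {S = true  ∷ S} (there i∈S) = cong suc (∣⊕⁅⁆∣-∈ i∈S)

∣p∣≡suc⇒Nonempty : ∀ {n} {S : Subset n} {k} → ∣ S ∣ ≡ suc k → Nonempty S
∣p∣≡suc⇒Nonempty {S = true  ∷ S} _  = zero , here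
∣p∣≡suc⇒Nonempty {S = false ∷ S} eq with ∣p∣≡suc⇒Nonempty eq
... | i , i∈S = suc i , there i∈S

Even : ℕ → Set
Even k = k % 2 ≡ 0

parity-⊕ : ∀ {n} (S T : Subset n) {a b} → ∣ S ∣ % 2 ≡ a → ∣ T ∣ % 2 ≡ b → ∣ S ⊕ T ∣ % 2 ≡ (a + b) % 2
parity-⊕ S T refl refl = begin
  ∣ S ⊕ T ∣ % 2                     ≡⟨ sym ([m+kn]%n≡m%n ∣ S ⊕ T ∣ ∣ S ∩ T ∣ 2) ⟩
  (∣ S ⊕ T ∣ + ∣ S ∩ T ∣ * 2) % 2   ≡⟨ cong (λ k → (∣ S ⊕ T ∣ + k) % 2) (*-comm ∣ S ∩ T ∣ 2) ⟩
  (∣ S ⊕ T ∣ + 2 * ∣ S ∩ T ∣) % 2   ≡⟨ cong (_% 2) (∣⊕∣+2∣∩∣ S T) ⟩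
  (∣ S ∣ + ∣ T ∣) % 2               ≡⟨ %-distribˡ-+ ∣ S ∣ ∣ T ∣ 2 ⟩
  (∣ S ∣ % 2 + ∣ T ∣ % 2) % 2       ∎

odd-⁅⁆ : ∀ {n} (i : Fin n) → Odd ∣ ⁅ i ⁆ ∣
odd-⁅⁆ i = cong (_% 2) (∣⁅x⁆∣≡1 i)

if-xor : ∀ {n} (a b : Bool) (P : Point n) →
         (if a xor b then P else 𝟎) ≡ (if a then P else 𝟎) ⊕ (if b then P else 𝟎)
if-xor false b     P = sym (⊕-identityˡ _)
if-xor true  false P = sym (⊕-identityʳ P)
if-xor true  true  P = sym (⊕-self P)

sumOver-⊕ : ∀ {m n} (p : Fin m → Point n) (S T : Subset m) →
            sumOver p (S ⊕ T) ≡ sumOver p S ⊕ sumOver p T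
sumOver-⊕ p []      []      = sym (⊕-self 𝟎)
sumOver-⊕ p (a ∷ S) (b ∷ T) =
  trans (cong₂ _⊕_ (if-xor a b (p zero)) (sumOver-⊕ (p ∘ suc) S T)) (⊕-interchange _ _ _ _)

sumOver-⊥ : ∀ {m n} (p : Fin m → Point n) → sumOver p ⊥ ≡ 𝟎
sumOver-⊥ {zero}  p = refl
sumOver-⊥ {suc m} p = trans (⊕-identityˡ _) (sumOver-⊥ (p ∘ suc))

sumOver-⁅⁆ : ∀ {m n} (p : Fin m → Point n) (i : Fin m) → sumOver p ⁅ i ⁆ ≡ p i
sumOver-⁅⁆ p zero    = trans (cong (p zero ⊕_) (sumOver-⊥ (p ∘ suc))) (⊕-identityʳ _)
sumOver-⁅⁆ p (suc i) = trans (⊕-identityˡ _) (sumOver-⁅⁆ (p ∘ suc) i)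

sumOver-⊕⁅⁆ : ∀ {m n} (p : Fin m → Point n) (S : Subset m) (i : Fin m) →
              sumOver p (S ⊕ ⁅ i ⁆) ≡ sumOver p S ⊕ p i
sumOver-⊕⁅⁆ p S i = trans (sumOver-⊕ p S ⁅ i ⁆) (cong (sumOver p S ⊕_) (sumOver-⁅⁆ p i))

Represents : ∀ {m n} → (Fin m → Point n) → Subset m → Subset m → Point n → Set
Represents p S R y = R ⊆ S × Odd ∣ R ∣ × sumOver p R ≡ y

-- Over ℤ₂ an affine dependency is the same as a nonempty even subset summing to 𝟎.
NoEvenZeroSum : ∀ {m n} → (Fin m → Point n) → Subset m → Set
NoEvenZeroSum p S = ∀ {T} → T ⊆ S → Even ∣ T ∣ → sumOver p T ≡ 𝟎 → Empty T

module _ {m n} {p : Fin m → Point n} {S : Subset m} where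

  affIndep⇒noEvenZeroSum : AffIndep p S → NoEvenZeroSum p S
  affIndep⇒noEvenZeroSum indep {T} T⊆S even-T sum-T (i , i∈T) =
    indep i (T⊆S i∈T) (T ⊕ ⁅ i ⁆ , T⊕i⊆S─i , parity-⊕ T ⁅ i ⁆ even-T (odd-⁅⁆ i) , sum)
    where
    T⊕i⊆S─i : T ⊕ ⁅ i ⁆ ⊆ S ─ ⁅ i ⁆
    T⊕i⊆S─i {j} j∈ with j ≟ i
    ... | yes refl = ⊥-elim (x∈p∧x∈q⇒x∉p⊕q i∈T (x∈⁅x⁆ i) j∈)
    ... | no  j≢i  = x∈p∧x∉q⇒x∈p─q (T⊆S (∈-⊕⁅⁆⁻ j∈ j≢i)) (x≢y⇒x∉⁅y⁆ j≢i)
    sum : sumOver p (T ⊕ ⁅ i ⁆) ≡ p i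
    sum = begin
      sumOver p (T ⊕ ⁅ i ⁆)  ≡⟨ sumOver-⊕⁅⁆ p T i ⟩
      sumOver p T ⊕ p i      ≡⟨ cong (_⊕ p i) sum-T ⟩
      𝟎 ⊕ p i                ≡⟨ ⊕-identityˡ (p i) ⟩
      p i                    ∎

  noEvenZeroSum⇒affIndep : NoEvenZeroSum p S → AffIndep p S
  noEvenZeroSum⇒affIndep free i i∈S (T , T⊆S─i , odd-T , sum-T) =
    free T⊕i⊆S (parity-⊕ T ⁅ i ⁆ odd-T (odd-⁅⁆ i)) sum (i , x∈p⊕q⁺ʳ i∉T (x∈⁅x⁆ i))
    where
    i∉T : i ∉ T
    i∉T i∈T = x∈p─q⇒x∉q (T⊆S─i i∈T) (x∈⁅x⁆ i)
    T⊕i⊆S : T ⊕ ⁅ i ⁆ ⊆ S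
    T⊕i⊆S = ⊆-⊕ (⊆-trans T⊆S─i (p─q⊆p S ⁅ i ⁆)) (⁅⁆-⊆ i∈S)
    sum : sumOver p (T ⊕ ⁅ i ⁆) ≡ 𝟎
    sum = begin
      sumOver p (T ⊕ ⁅ i ⁆)  ≡⟨ sumOver-⊕⁅⁆ p T i ⟩
      sumOver p T ⊕ p i      ≡⟨ cong (_⊕ p i) sum-T ⟩
      p i ⊕ p i              ≡⟨ ⊕-self (p i) ⟩
      𝟎                      ∎

module Exchange {m n} (p : Fin m → Point n) {S B T : Subset m} {x c : Fin m}
                (basis : IsBasisOf p S B) (x∈S : x ∈ S) (x∉B : x ∉ B)
                (rep : Represents p B T (p x)) (c∈T : c ∈ T) where

  B′ : Subset m
  B′ = B ⊕ ⁅ c ⁆ ⊕ ⁅ x ⁆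

  private
    T⊆B : T ⊆ B
    T⊆B = proj₁ rep

    c∈B : c ∈ B
    c∈B = T⊆B c∈T

    c≢x : c ≢ x
    c≢x refl = x∉B c∈B

    c∉B′ : c ∉ B′
    c∉B′ = ∉-⊕⁅⁆ (x∈p∧x∈q⇒x∉p⊕q c∈B (x∈⁅x⁆ c)) c≢x

    x∉B⊕c : x ∉ B ⊕ ⁅ c ⁆
    x∉B⊕c = ∉-⊕⁅⁆ x∉B (c≢x ∘ sym)

    B-free : NoEvenZeroSum p B
    B-free = affIndep⇒noEvenZeroSum (proj₁ (proj₂ basis))

  sumOver-⊕T⊕x : ∀ R → sumOver p (R ⊕ T ⊕ ⁅ x ⁆) ≡ sumOver p R
  sumOver-⊕T⊕x R = begin
    sumOver p (R ⊕ T ⊕ ⁅ x ⁆)        ≡⟨ sumOver-⊕⁅⁆ p (R ⊕ T) x ⟩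
    sumOver p (R ⊕ T) ⊕ p x          ≡⟨ cong (_⊕ p x) (sumOver-⊕ p R T) ⟩
    sumOver p R ⊕ sumOver p T ⊕ p x  ≡⟨ cong (λ t → sumOver p R ⊕ t ⊕ p x) (proj₂ (proj₂ rep)) ⟩
    sumOver p R ⊕ p x ⊕ p x          ≡⟨ ⊕-involutive (sumOver p R) (p x) ⟩
    sumOver p R                      ∎

  represents-B′-∉ : ∀ {R y} → Represents p B R y → c ∉ R → Represents p B′ R y
  represents-B′-∉ (R⊆B , odd-R , sum-R) c∉R =
    ⊆-⊕⁅⁆⁺ (x∉B ∘ R⊆B) (⊆-⊕⁅⁆⁺ c∉R R⊆B) , odd-R , sum-R

  represents-B′-∈ : ∀ {R y} → Represents p B R y → c ∈ R → Represents p B′ (R ⊕ T ⊕ ⁅ x ⁆) y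
  represents-B′-∈ {R} (R⊆B , odd-R , sum-R) c∈R =
    ⊕⁅⁆-mono-⊆ x∉B⊕c (⊆-⊕⁅⁆⁺ (x∈p∧x∈q⇒x∉p⊕q c∈R c∈T) (⊆-⊕ R⊆B T⊆B)) ,
    parity-⊕ (R ⊕ T) ⁅ x ⁆ (parity-⊕ R T odd-R (proj₁ (proj₂ rep))) (odd-⁅⁆ x) ,
    trans (sumOver-⊕T⊕x R) sum-R

  affComb-B′ : ∀ {y} → AffComb p B y → AffComb p B′ y
  affComb-B′ (R , rep-R) with c ∈? R
  ... | yes c∈R = R ⊕ T ⊕ ⁅ x ⁆ , represents-B′-∈ rep-R c∈R
  ... | no  c∉R = R , represents-B′-∉ rep-R c∉R

  -- An even zero sum U ⊆ B′ through x would give the even zero sum U + x + T ⊆ B through c.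
  noEvenZeroSum-B′ : NoEvenZeroSum p B′
  noEvenZeroSum-B′ {U} U⊆B′ even-U sum-U with x ∈? U
  ... | no  x∉U = B-free (⊆-⊕⁅⁆⁻ c∉U (⊆-⊕⁅⁆⁻ x∉U U⊆B′)) even-U sum-U
    where
    c∉U : c ∉ U
    c∉U = c∉B′ ∘ U⊆B′
  ... | yes x∈U = λ _ → B-free V⊆B even-V sum-V (c , x∈p⊕q⁺ʳ c∉U⊕x c∈T)
    where
    c∉U⊕x : c ∉ U ⊕ ⁅ x ⁆
    c∉U⊕x = ∉-⊕⁅⁆ (c∉B′ ∘ U⊆B′) c≢x
    V⊆B : U ⊕ ⁅ x ⁆ ⊕ T ⊆ B
    V⊆B = ⊆-⊕ (⊆-⊕⁅⁆⁻ c∉U⊕x (⊕⁅⁆-⊆ x∈U U⊆B′)) T⊆B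
    even-V : Even ∣ U ⊕ ⁅ x ⁆ ⊕ T ∣
    even-V = parity-⊕ (U ⊕ ⁅ x ⁆) T (parity-⊕ U ⁅ x ⁆ even-U (odd-⁅⁆ x)) (proj₁ (proj₂ rep))
    sum-V : sumOver p (U ⊕ ⁅ x ⁆ ⊕ T) ≡ 𝟎
    sum-V = begin
      sumOver p (U ⊕ ⁅ x ⁆ ⊕ T)          ≡⟨ sumOver-⊕ p (U ⊕ ⁅ x ⁆) T ⟩
      sumOver p (U ⊕ ⁅ x ⁆) ⊕ sumOver p T ≡⟨ cong₂ _⊕_ (sumOver-⊕⁅⁆ p U x) (proj₂ (proj₂ rep)) ⟩
      sumOver p U ⊕ p x ⊕ p x            ≡⟨ ⊕-involutive (sumOver p U) (p x) ⟩
      sumOver p U                        ≡⟨ sum-U ⟩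
      𝟎                                  ∎

  basis-B′ : IsBasisOf p S B′
  basis-B′ = B′⊆S , noEvenZeroSum⇒affIndep noEvenZeroSum-B′ , λ y → mk⇔ (weaken y) (strengthen y)
    where
    B′⊆S : B′ ⊆ S
    B′⊆S = ⊆-⊕ (⊆-⊕ (proj₁ basis) (⁅⁆-⊆ (proj₁ basis c∈B))) (⁅⁆-⊆ x∈S)
    weaken : ∀ y → AffComb p B′ y → AffComb p S y
    weaken y (R , R⊆B′ , odd-R , sum-R) = R , ⊆-trans R⊆B′ B′⊆S , odd-R , sum-R
    strengthen : ∀ y → AffComb p S y → AffComb p B′ y
    strengthen y = affComb-B′ ∘ Equivalence.from (proj₂ (proj₂ basis) y)

  ∁-B′ : ∀ {y} → y ≢ x → y ≢ c → ∁ B ≡ ⁅ y ⁆ ∪ ⁅ x ⁆ → ∁ B′ ≡ ⁅ y ⁆ ∪ ⁅ c ⁆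
  ∁-B′ {y} y≢x y≢c ∁B = begin
    ∁ (B ⊕ ⁅ c ⁆ ⊕ ⁅ x ⁆)           ≡⟨ trans (∁-⊕ (B ⊕ ⁅ c ⁆) ⁅ x ⁆) (cong (_⊕ ⁅ x ⁆) (∁-⊕ B ⁅ c ⁆)) ⟩
    ∁ B ⊕ ⁅ c ⁆ ⊕ ⁅ x ⁆             ≡⟨ cong (λ D → D ⊕ ⁅ c ⁆ ⊕ ⁅ x ⁆) (trans ∁B (singletons y≢x)) ⟩
    ⁅ y ⁆ ⊕ ⁅ x ⁆ ⊕ ⁅ c ⁆ ⊕ ⁅ x ⁆   ≡⟨ ⊕-assoc (⁅ y ⁆ ⊕ ⁅ x ⁆) ⁅ c ⁆ ⁅ x ⁆ ⟩
    ⁅ y ⁆ ⊕ ⁅ x ⁆ ⊕ (⁅ c ⁆ ⊕ ⁅ x ⁆) ≡⟨ ⊕-cancel-common ⁅ y ⁆ ⁅ c ⁆ ⁅ x ⁆ ⟩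
    ⁅ y ⁆ ⊕ ⁅ c ⁆                   ≡⟨ sym (singletons y≢c) ⟩
    ⁅ y ⁆ ∪ ⁅ c ⁆                   ∎
    where
    singletons : ∀ {i j} → i ≢ j → ⁅ i ⁆ ∪ ⁅ j ⁆ ≡ ⁅ i ⁆ ⊕ ⁅ j ⁆
    singletons {i} {j} i≢j = disjoint⇒∪≡⊕ ⁅ i ⁆ ⁅ j ⁆ λ k∈i k∈j →
      i≢j (trans (sym (x∈⁅y⁆⇒x≡y i k∈i)) (x∈⁅y⁆⇒x≡y j k∈j))

module _ {m} {T₁ T₂ : Subset m} {c i : Fin m} (c∈T₁ : c ∈ T₁) (c∈T₂ : c ∈ T₂) (i∉T₁ : i ∉ T₁) (i∉T₂ : i ∉ T₂)
         (∣T₁∣ : ∣ T₁ ∣ ≡ 7) (∣T₂∣ : ∣ T₂ ∣ ≡ 5) (∣T₁∩T₂∣ : ∣ T₁ ∩ T₂ ∣ ≡ 4) where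

  ∣T₁⊕T₂⊕i∣≡5 : ∣ T₁ ⊕ T₂ ⊕ ⁅ i ⁆ ∣ ≡ 5
  ∣T₁⊕T₂⊕i∣≡5 = trans (∣⊕⁅⁆∣-∉ (x∉p∧x∉q⇒x∉p⊕q i∉T₁ i∉T₂)) (cong suc ∣T₁⊕T₂∣≡4)
    where
    ∣T₁⊕T₂∣≡4 : ∣ T₁ ⊕ T₂ ∣ ≡ 4
    ∣T₁⊕T₂∣≡4 = +-cancelʳ-≡ 8 ∣ T₁ ⊕ T₂ ∣ 4 (begin
      ∣ T₁ ⊕ T₂ ∣ + 2 * 4            ≡⟨ cong (λ k → ∣ T₁ ⊕ T₂ ∣ + 2 * k) (sym ∣T₁∩T₂∣) ⟩
      ∣ T₁ ⊕ T₂ ∣ + 2 * ∣ T₁ ∩ T₂ ∣  ≡⟨ ∣⊕∣+2∣∩∣ T₁ T₂ ⟩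
      ∣ T₁ ∣ + ∣ T₂ ∣                ≡⟨ cong₂ _+_ ∣T₁∣ ∣T₂∣ ⟩
      12                             ∎)

  ∣c⊕T₂⊕i∣≡5 : ∣ ⁅ c ⁆ ⊕ T₂ ⊕ ⁅ i ⁆ ∣ ≡ 5
  ∣c⊕T₂⊕i∣≡5 = trans (∣⊕⁅⁆∣-∉ (x∉p∧x∉q⇒x∉p⊕q (x≢y⇒x∉⁅y⁆ i≢c) i∉T₂)) (cong suc ∣c⊕T₂∣≡4)
    where
    i≢c : i ≢ c
    i≢c refl = i∉T₁ c∈T₁
    ∣c⊕T₂∣≡4 : ∣ ⁅ c ⁆ ⊕ T₂ ∣ ≡ 4
    ∣c⊕T₂∣≡4 = suc-injective (trans (cong (suc ∘ ∣_∣) (⊕-comm ⁅ c ⁆ T₂)) (trans (∣⊕⁅⁆∣-∈ c∈T₂) ∣T₂∣))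

  ∣∩∣≡2 : ∣ (T₁ ⊕ T₂ ⊕ ⁅ i ⁆) ∩ (⁅ c ⁆ ⊕ T₂ ⊕ ⁅ i ⁆) ∣ ≡ 2
  ∣∩∣≡2 = *-cancelˡ-≡ _ 2 2 (+-cancelˡ-≡ 6 _ _ (begin
    6 + 2 * ∣ R₁ ∩ R₂ ∣            ≡⟨ cong (_+ 2 * ∣ R₁ ∩ R₂ ∣) (sym ∣R₁⊕R₂∣≡6) ⟩
    ∣ R₁ ⊕ R₂ ∣ + 2 * ∣ R₁ ∩ R₂ ∣  ≡⟨ ∣⊕∣+2∣∩∣ R₁ R₂ ⟩
    ∣ R₁ ∣ + ∣ R₂ ∣                ≡⟨ cong₂ _+_ ∣T₁⊕T₂⊕i∣≡5 ∣c⊕T₂⊕i∣≡5 ⟩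
    10                             ∎))
    where
    R₁ R₂ : Subset m
    R₁ = T₁ ⊕ T₂ ⊕ ⁅ i ⁆
    R₂ = ⁅ c ⁆ ⊕ T₂ ⊕ ⁅ i ⁆
    ∣R₁⊕R₂∣≡6 : ∣ R₁ ⊕ R₂ ∣ ≡ 6
    ∣R₁⊕R₂∣≡6 = begin
      ∣ R₁ ⊕ R₂ ∣                  ≡⟨ cong ∣_∣ (⊕-cancel-common (T₁ ⊕ T₂) (⁅ c ⁆ ⊕ T₂) ⁅ i ⁆) ⟩
      ∣ T₁ ⊕ T₂ ⊕ (⁅ c ⁆ ⊕ T₂) ∣   ≡⟨ cong ∣_∣ (⊕-cancel-common T₁ ⁅ c ⁆ T₂) ⟩
      ∣ T₁ ⊕ ⁅ c ⁆ ∣               ≡⟨ suc-injective (trans (∣⊕⁅⁆∣-∈ c∈T₁) ∣T₁∣) ⟩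
      6                            ∎

  sizes-5-5-2 : ∣ T₁ ⊕ T₂ ⊕ ⁅ i ⁆ ∣ ≡ 5 × ∣ ⁅ c ⁆ ⊕ T₂ ⊕ ⁅ i ⁆ ∣ ≡ 5 ×
                ∣ (T₁ ⊕ T₂ ⊕ ⁅ i ⁆) ∩ (⁅ c ⁆ ⊕ T₂ ⊕ ⁅ i ⁆) ∣ ≡ 2
  sizes-5-5-2 = ∣T₁⊕T₂⊕i∣≡5 , ∣c⊕T₂⊕i∣≡5 , ∣∩∣≡2

theorem5p3 : (n : ℕ) (p : Fin 10 → Point n) → Injective _≡_ _≡_ p → IsCap p →
    HasDim p ⊤ 7 →
    Σ (Subset 10) (λ B → IsBasisOf p ⊤ B × ExtType p B 7 5 4) →
    Σ (Subset 10) (λ B → IsBasisOf p ⊤ B × ExtType p B 5 5 2)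
theorem5p3 _ p _ _ _ (B , basis , x₁ , x₂ , x₁≢x₂ , ∁B , T₁ , T₂ , rep₁ , rep₂ , ∣T₁∣ , ∣T₂∣ , ∣T₁∩T₂∣)
  with ∣p∣≡suc⇒Nonempty ∣T₁∩T₂∣
... | c , c∈T₁∩T₂ =
  B′ , basis-B′ , x₁ , c , x₁≢c , ∁-B′ x₁≢x₂ x₁≢c ∁B ,
  T₁ ⊕ T₂ ⊕ ⁅ x₂ ⁆ , ⁅ c ⁆ ⊕ T₂ ⊕ ⁅ x₂ ⁆ ,
  represents-B′-∈ rep₁ c∈T₁ , represents-B′-∈ (⁅⁆-⊆ c∈B , odd-⁅⁆ c , sumOver-⁅⁆ p c) (x∈⁅x⁆ c) ,
  sizes-5-5-2 c∈T₁ c∈T₂ (x₂∉B ∘ proj₁ rep₁) (x₂∉B ∘ proj₁ rep₂) ∣T₁∣ ∣T₂∣ ∣T₁∩T₂∣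
  where
  dependent : ∀ {i} → i ∈ ⁅ x₁ ⁆ ⊎ i ∈ ⁅ x₂ ⁆ → i ∉ B
  dependent = x∈∁p⇒x∉p ∘ subst (_ ∈_) (sym ∁B) ∘ x∈p∪q⁺
  x₂∉B : x₂ ∉ B
  x₂∉B = dependent (inj₂ (x∈⁅x⁆ x₂))
  c∈T₁ : c ∈ T₁
  c∈T₁ = proj₁ (x∈p∩q⁻ T₁ T₂ c∈T₁∩T₂)
  c∈T₂ : c ∈ T₂
  c∈T₂ = proj₂ (x∈p∩q⁻ T₁ T₂ c∈T₁∩T₂)
  c∈B : c ∈ B
  c∈B = proj₁ rep₂ c∈T₂
  x₁≢c : x₁ ≢ c
  x₁≢c refl = dependent (inj₁ (x∈⁅x⁆ x₁)) c∈B
  open Exchange p basis ∈⊤ x₂∉B rep₂ c∈T₂
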